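{- For $a\in\mathbb{Q}$, let $\mathcal{R}_a$ be the rectangle in the plane with vertices $P_1=(0,0)$, $P_2=(0,1)$, $P_3=(a,0)$, $P_4=(a,1)$. Then the set of $a\in\mathbb{Q}$ for which there are infinitely many points $M\in\mathbb{Q}^2$ such that each of the distances $|MP_1|,|MP_2|,|MP_3|,|MP_4|$ is rational is dense in $\mathbb{R}$.
   Context: Distances are Euclidean distances in $\mathbb{R}^2$. -}

module Defs where

open import Data.Rational using (ℚ; 0ℚ; 1ℚ; _+_; _*_; _-_; _≤_; _<_)
open import Data.Product using (_×_; _,_; ∃)
open import Data.List using (List)
open import Data.List.Membership.Propositional using (_∉_)
open import Relation.Binary.PropositionalEquality using (_≡_)

Point : Set
Point = ℚ × ℚ

dist² : Point → Point → ℚ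
dist² (x₁ , y₁) (x₂ , y₂) = (x₁ - x₂) * (x₁ - x₂) + (y₁ - y₂) * (y₁ - y₂)

RationalDistance : Point → Point → Set
RationalDistance P Q = ∃ λ (r : ℚ) → (0ℚ ≤ r) × (r * r ≡ dist² P Q)

P₁ P₂ P₃ P₄ : ℚ → Point
P₁ a = (0ℚ , 0ℚ)
P₂ a = (0ℚ , 1ℚ)
P₃ a = (a , 0ℚ)
P₄ a = (a , 1ℚ)

GoodPoint : ℚ → Point → Set
GoodPoint a M = RationalDistance M (P₁ a) × RationalDistance M (P₂ a)
              × RationalDistance M (P₃ a) × RationalDistance M (P₄ a)

InfinitelyMany : {A : Set} → (A → Set) → Set
InfinitelyMany {A} P = (L : List A) → ∃ λ (x : A) → P x × x ∉ L

GoodParameter : ℚ → Set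
GoodParameter a = InfinitelyMany (GoodPoint a)

-- a subset of ℚ is dense in ℝ: every nonempty open interval (with rational
-- endpoints, which suffices) contains an element of it
DenseInℝ : (ℚ → Set) → Set
DenseInℝ S = (p q : ℚ) → p < q → ∃ λ (a : ℚ) → (p < a) × (a < q) × S a

module Submission where

-- On the axis y = 0 a point (X , 0) has rational distances to the four vertices as soon as
-- X² + 1 and (X - a)² + 1 are squares, that is X = h u and X - a = h v with h u = (u - 1/u) / 2.
-- For a = p / q such pairs (u , v) come from rational points of the elliptic curve
-- y² = x³ + (p² + 2q²) x² + q⁴ x. If a = h (2R / e₂) - h (S / 2e₂) with e₂, S, R odd, the
-- curve has an explicit point P₀, and doubling (a 2-isogeny followed by its dual) raises the power
-- of 2 in the denominator: the abscissa obtained from 2ᵏ P₀ has a denominator divisible by 2ᵏ⁺¹,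
-- so infinitely many good points arise. Such a are dense: e₁ / 4e₂ with e₁ = 4R - S can be put just
-- above any m / D, and a = (e₁ / 4e₂) (1 + e₂² / SR) stays below (m + 1) / D when S and R are large.

open import Defs

open import Data.Nat.Base as ℕ using (ℕ; zero; suc)
import Data.Nat.Properties as ℕP
open import Data.Nat.GeneralisedArithmetic using (fold)
open import Data.Integer.Base as ℤ using (ℤ; +_; -[1+_])
import Data.Integer.Properties as ℤP
open import Data.Sum using (inj₁; inj₂; [_,_]′)
open import Relation.Nullary using (¬_; contradiction)
open import Data.Product using (Σ; ∃; _×_; _,_; proj₁; proj₂)
open import Function.Base using (_∘_)
open import Relation.Binary.PropositionalEquality

module Parity where
  open import Data.Integer.Base using (_+_; _*_; _-_; -_)
  open import Data.Integer.Tactic.RingSolver using (solve-∀)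
  import Data.Nat.Divisibility as ℕD
  open import Data.Nat.Primality using (euclidsLemma; prime[2])
  import Data.Integer.Divisibility.Signed as ℤD

  Odd : ℤ → Set
  Odd z = ∃ λ k → z ≡ + 1 + + 2 * k

  odd-1 : Odd (+ 1)
  odd-1 = + 0 , refl

  odd-* : ∀ {a b} → Odd a → Odd b → Odd (a * b)
  odd-* (k , refl) (l , refl) = k + l + + 2 * k * l , expand k l
    where
    expand : ∀ k l → (+ 1 + + 2 * k) * (+ 1 + + 2 * l) ≡ + 1 + + 2 * (k + l + + 2 * k * l)
    expand = solve-∀

  odd-neg : ∀ {a} → Odd a → Odd (- a)
  odd-neg (k , refl) = - k - + 1 , expand k
    where
    expand : ∀ k → - (+ 1 + + 2 * k) ≡ + 1 + + 2 * (- k - + 1)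
    expand = solve-∀

  even+odd : ∀ {a} c → Odd a → Odd (+ 2 * c + a)
  even+odd c (k , refl) = c + k , expand c k
    where
    expand : ∀ c k → + 2 * c + (+ 1 + + 2 * k) ≡ + 1 + + 2 * (c + k)
    expand = solve-∀

  even-odd : ∀ {a} c → Odd a → Odd (+ 2 * c - a)
  even-odd c (k , refl) = c - k - + 1 , expand c k
    where
    expand : ∀ c k → + 2 * c - (+ 1 + + 2 * k) ≡ + 1 + + 2 * (c - k - + 1)
    expand = solve-∀

  odd-even : ∀ {a} c → Odd a → Odd (a - + 2 * c)
  odd-even c (k , refl) = k - c , expand c k
    where
    expand : ∀ c k → + 1 + + 2 * k - + 2 * c ≡ + 1 + + 2 * (k - c)
    expand = solve-∀

  odd⇒≢0 : ∀ {a} → Odd a → a ≢ + 0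
  odd⇒≢0 (k , refl) 1+2k≡0 with ℕP.m*n≡1⇒m≡1 2 ℤ.∣ k ∣ (begin
      2 ℕ.* ℤ.∣ k ∣                 ≡⟨ ℤP.abs-* (+ 2) k ⟨
      ℤ.∣ + 2 * k ∣                 ≡⟨ cong ℤ.∣_∣ (isolate k) ⟩
      ℤ.∣ + 1 + + 2 * k - + 1 ∣     ≡⟨ cong (λ x → ℤ.∣ x - + 1 ∣) 1+2k≡0 ⟩
      1                             ∎)
    where
    open ≡-Reasoning
    isolate : ∀ k → + 2 * k ≡ + 1 + + 2 * k - + 1
    isolate = solve-∀
  ... | ()

  2≢0 : + 2 ≢ + 0
  2≢0 ()

  *-≢0 : ∀ {a b} → a ≢ + 0 → b ≢ + 0 → a * b ≢ + 0
  *-≢0 {a} a≢0 b≢0 ab≡0 = [ a≢0 , b≢0 ]′ (ℤP.i*j≡0⇒i≡0∨j≡0 a ab≡0)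

  2^≢0 : ∀ m → + (2 ℕ.^ m) ≢ + 0
  2^≢0 m 2^m≡0 = ℕP.<⇒≢ (ℕP.m^n>0 2 m) (sym (ℤP.+-injective 2^m≡0))

  2^suc-* : ∀ k e → + (2 ℕ.^ suc k) * e ≡ + 2 * (+ (2 ℕ.^ k) * e)
  2^suc-* k e = trans (cong (_* e) (ℤP.pos-* 2 (2 ℕ.^ k))) (ℤP.*-assoc (+ 2) (+ (2 ℕ.^ k)) e)

  odd⇒∤ : ∀ {a} → Odd a → ¬ (2 ℕD.∣ ℤ.∣ a ∣)
  odd⇒∤ (k , refl) 2∣a = ℕP.<⇒≱ (ℕP.n<1+n 1) (ℕD.∣⇒≤ (ℤD.∣⇒∣ᵤ 2∣1))
    where
    2∣1 : + 2 ℤD.∣ + 1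
    2∣1 = ℤD.∣m+n∣n⇒∣m (ℤD.∣ᵤ⇒∣ 2∣a) (ℤD.divides k (ℤP.*-comm (+ 2) k))

  2^∣odd*⇒2^∣ : ∀ m a b → ¬ (2 ℕD.∣ a) → 2 ℕ.^ m ℕD.∣ a ℕ.* b → 2 ℕ.^ m ℕD.∣ b
  2^∣odd*⇒2^∣ zero    a b 2∤a _ = ℕD.1∣ b
  2^∣odd*⇒2^∣ (suc m) a b 2∤a 2^[1+m]∣ab
    with euclidsLemma a b prime[2] (ℕD.∣-trans (ℕD.m∣m*n (2 ℕ.^ m)) 2^[1+m]∣ab)
  ... | inj₁ 2∣a = contradiction 2∣a 2∤a
  ... | inj₂ (ℕD.divides b′ refl) =
    subst (2 ℕ.^ suc m ℕD.∣_) (ℕP.*-comm 2 b′)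
      (ℕD.*-monoʳ-∣ 2 (2^∣odd*⇒2^∣ m a b′ 2∤a
        (ℕD.*-cancelˡ-∣ 2 (subst (2 ℕ.^ suc m ℕD.∣_) (regroup a b′) 2^[1+m]∣ab))))
    where
    regroup : ∀ a b′ → a ℕ.* (b′ ℕ.* 2) ≡ 2 ℕ.* (a ℕ.* b′)
    regroup a b′ = trans (sym (ℕP.*-assoc a b′ 2)) (ℕP.*-comm (a ℕ.* b′) 2)

  n<2^n : ∀ n → n ℕ.< 2 ℕ.^ n
  n<2^n zero    = ℕ.z<s
  n<2^n (suc n) = ℕP.<-≤-trans (ℕP.+-mono-≤-< (ℕP.m^n>0 2 n) (n<2^n n))
                               (ℕP.≤-reflexive (cong (2 ℕ.^ n ℕ.+_) (sym (ℕP.+-identityʳ (2 ℕ.^ n)))))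

open Parity

-- A triple (n , d , y) stands for the affine point (n / d², y / d³) of y² = x³ + A x² + B x.
module EllipticCurve where
  open import Data.Integer.Base using (_+_; _*_; _-_; -_)
  open import Data.Integer.Tactic.RingSolver using (solve-∀)

  WeightedPoint : Set
  WeightedPoint = ℤ × ℤ × ℤ

  cubic : ℤ → ℤ → ℤ → ℤ → ℤ
  cubic A B n d = n * n * n + A * (n * n) * (d * d) + B * n * (d * d * (d * d))

  OnCurve : ℤ → ℤ → WeightedPoint → Set
  OnCurve A B (n , d , y) = y * y ≡ cubic A B n d

  onCurve⇒vanishing : ∀ A B n d y → OnCurve A B (n , d , y) → y * y - cubic A B n d ≡ + 0
  onCurve⇒vanishing A B n d y y²≡c = trans (cong (_- cubic A B n d) y²≡c) (ℤP.+-inverseʳ (cubic A B n d))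

  -- the 2-isogeny (x , y) ↦ (y² / x² , y (B - x²) / x²) onto y² = x³ - 2A x² + (A² - 4B) x
  isogeny : ℤ → WeightedPoint → WeightedPoint
  isogeny B (n , d , y) = y * y , n * d , y * n * (B * (d * d * (d * d)) - n * n)

  isogeny-onCurve : ∀ A B s → OnCurve A B s → OnCurve (- (+ 2 * A)) (A * A - + 4 * B) (isogeny B s)
  isogeny-onCurve A B (n , d , y) on = begin
    (y * n * M) * (y * n * M)                               ≡⟨ regroup y n M (y * y) R ⟩
    y * y * (n * n * (M * M)) + y * y * + 0 * R             ≡⟨ cong (λ t → y * y * (n * n * (M * M)) + y * y * t * R)
                                                                    (onCurve⇒vanishing A B n d y on) ⟨
    y * y * (n * n * (M * M)) + y * y * (y * y - cubic A B n d) * R ≡⟨ isogeny-identity A B n d (y * y) ⟩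
    cubic (- (+ 2 * A)) (A * A - + 4 * B) (y * y) (n * d)   ∎
    where
    open ≡-Reasoning
    M = B * (d * d * (d * d)) - n * n
    R = y * y - n * (A * n * (d * d) - n * n - B * (d * d * (d * d)))
    regroup : ∀ y n M F R → (y * n * M) * (y * n * M) ≡ y * y * (n * n * (M * M)) + F * + 0 * R
    regroup = solve-∀
    isogeny-identity : ∀ A B n d F →
      F * (n * n * ((B * (d * d * (d * d)) - n * n) * (B * (d * d * (d * d)) - n * n)))
        + F * (F - (n * n * n + A * (n * n) * (d * d) + B * n * (d * d * (d * d))))
            * (F - n * (A * n * (d * d) - n * n - B * (d * d * (d * d))))
      ≡ F * F * F + - (+ 2 * A) * (F * F) * ((n * d) * (n * d))
          + (A * A - + 4 * B) * F * ((n * d) * (n * d) * ((n * d) * (n * d)))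
    isogeny-identity = solve-∀

  -- the isomorphism (x , y) ↦ (x / 4 , y / 8) from y² = x³ + 4A x² + 16B x onto y² = x³ + A x² + B x
  rescale : WeightedPoint → WeightedPoint
  rescale (n , d , y) = n , + 2 * d , y

  rescale-onCurve : ∀ A B s → OnCurve (+ 4 * A) (+ 16 * B) s → OnCurve A B (rescale s)
  rescale-onCurve A B (n , d , y) y²≡c = trans y²≡c (rescale-identity A B n d)
    where
    rescale-identity : ∀ A B n d →
      n * n * n + + 4 * A * (n * n) * (d * d) + + 16 * B * n * (d * d * (d * d))
      ≡ n * n * n + A * (n * n) * ((+ 2 * d) * (+ 2 * d)) + B * n * ((+ 2 * d) * (+ 2 * d) * ((+ 2 * d) * (+ 2 * d)))
    rescale-identity = solve-∀

  -- the composite of the isogeny and its dual is multiplication by 2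
  double : ℤ → ℤ → WeightedPoint → WeightedPoint
  double A B = rescale ∘ isogeny (A * A - + 4 * B) ∘ isogeny B

  double-onCurve : ∀ A B s → OnCurve A B s → OnCurve A B (double A B s)
  double-onCurve A B s on =
    rescale-onCurve A B s₂ (subst₂ (λ A″ B″ → OnCurve A″ B″ s₂) (dual-A A) (dual-B A B)
      (isogeny-onCurve A' B' s₁ (isogeny-onCurve A B s on)))
    where
    A' = - (+ 2 * A)
    B' = A * A - + 4 * B
    s₁ = isogeny B s
    s₂ = isogeny B' s₁
    dual-A : ∀ A → - (+ 2 * - (+ 2 * A)) ≡ + 4 * A
    dual-A = solve-∀
    dual-B : ∀ A B → - (+ 2 * A) * - (+ 2 * A) - + 4 * (A * A - + 4 * B) ≡ + 16 * B
    dual-B = solve-∀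

  TwoAdic : ℕ → WeightedPoint → Set
  TwoAdic k (n , d , y) = Odd n × Odd y × ∃ λ e → Odd e × d ≡ + (2 ℕ.^ suc k) * e

  isogeny-twoAdic : ∀ B k s → TwoAdic k s → TwoAdic k (isogeny B s)
  isogeny-twoAdic B k (n , _ , y) (odd-n , odd-y , e , odd-e , refl) =
    odd-* odd-y odd-y ,
    odd-* (odd-* odd-y odd-n) (subst (λ d → Odd (B * (d * d * (d * d)) - n * n)) (sym (2^suc-* k e))
                                (subst Odd (regroup B h n) (even-odd (+ 8 * B * (h * h * (h * h))) (odd-* odd-n odd-n)))) ,
    n * e , odd-* odd-n odd-e , swap n (+ (2 ℕ.^ suc k)) e
    where
    h = + (2 ℕ.^ k) * e
    regroup : ∀ B h n → + 2 * (+ 8 * B * (h * h * (h * h))) - n * n ≡ B * ((+ 2 * h) * (+ 2 * h) * ((+ 2 * h) * (+ 2 * h))) - n * n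
    regroup = solve-∀
    swap : ∀ n a e → n * (a * e) ≡ a * (n * e)
    swap = solve-∀

  rescale-twoAdic : ∀ k s → TwoAdic k s → TwoAdic (suc k) (rescale s)
  rescale-twoAdic k (_ , _ , _) (odd-n , odd-y , e , odd-e , refl) =
    odd-n , odd-y , e , odd-e , sym (2^suc-* (suc k) e)

  double-twoAdic : ∀ A B k s → TwoAdic k s → TwoAdic (suc k) (double A B s)
  double-twoAdic A B k s =
    rescale-twoAdic k _ ∘ isogeny-twoAdic (A * A - + 4 * B) k (isogeny B s) ∘ isogeny-twoAdic B k s

  multiples-onCurve-twoAdic : ∀ A B s → OnCurve A B s → TwoAdic 0 s →
    ∀ k → OnCurve A B (fold s (double A B) k) × TwoAdic k (fold s (double A B) k)
  multiples-onCurve-twoAdic A B s on t zero    = on , t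
  multiples-onCurve-twoAdic A B s on t (suc k) =
    let on-k , t-k = multiples-onCurve-twoAdic A B s on t k
    in double-onCurve A B (fold s (double A B) k) on-k , double-twoAdic A B k (fold s (double A B) k) t-k

  curveA curveB : ℤ → ℤ → ℤ
  curveA p q = p * p + + 2 * (q * q)
  curveB p q = q * q * (q * q)

open EllipticCurve

module Pythagorean where
  open import Data.Integer.Base using (_+_; _*_; _-_)
  open import Data.Integer.Tactic.RingSolver using (solve-∀)

  odd-leg even-leg hypotenuse : ℤ → ℤ → ℤ
  odd-leg    t w = t * t - w * w
  even-leg   t w = + 2 * t * w
  hypotenuse t w = t * t + w * w

  pythagoras : ∀ t w → hypotenuse t w * hypotenuse t w ≡ odd-leg t w * odd-leg t w + even-leg t w * even-leg t w
  pythagoras t w = expand t w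
    where
    expand : ∀ t w → (t * t + w * w) * (t * t + w * w) ≡ (t * t - w * w) * (t * t - w * w) + (+ 2 * t * w) * (+ 2 * t * w)
    expand = solve-∀

  -- (t² - w²) / 2tw = (t/w - w/t) / 2, and differences of such values factor
  legs-difference : ∀ t w s r →
    odd-leg t w * even-leg s r - odd-leg s r * even-leg t w ≡ + 2 * ((t * r - s * w) * (t * s + w * r))
  legs-difference t w s r = expand t w s r
    where
    expand : ∀ t w s r →
      (t * t - w * w) * (+ 2 * s * r) - (s * s - r * r) * (+ 2 * t * w) ≡ + 2 * ((t * r - s * w) * (t * s + w * r))
    expand = solve-∀

open Pythagorean

-- For a = p / q, a point of y² = x³ + (p² + 2q²) x² + q⁴ x yields the abscissae
-- X = h (t / w) and X - a = h (s / r), where h u = (u - 1/u) / 2 makes h u ² + 1 a square.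
module CurveAbscissae (p q n d y : ℤ) where
  open import Data.Integer.Base using (_+_; _*_; _-_; -_)
  open import Data.Integer.Tactic.RingSolver using (solve-∀)

  z H t w s r : ℤ
  z = p * n * d - y
  H = n + q * q * (d * d)
  t = q * d * z
  w = n * H
  s = - z
  r = q * d * H

  curve-in-z-H : OnCurve (curveA p q) (curveB p q) (n , d , y) → n * H * H - z * z + + 2 * p * d * n * z ≡ + 0
  curve-in-z-H on = trans (expand n d y p q) (cong -_ (onCurve⇒vanishing (curveA p q) (curveB p q) n d y on))
    where
    expand : ∀ n d y p q →
      n * (n + q * q * (d * d)) * (n + q * q * (d * d)) - (p * n * d - y) * (p * n * d - y) + + 2 * p * d * n * (p * n * d - y)
      ≡ - (y * y - (n * n * n + (p * p + + 2 * (q * q)) * (n * n) * (d * d) + q * q * (q * q) * n * (d * d * (d * d))))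
    expand = solve-∀

  product-relation : OnCurve (curveA p q) (curveB p q) (n , d , y) → q * ((t * r - s * w) * (t * s + w * r)) ≡ + 2 * p * t * w * s * r
  product-relation on = begin
    q * ((t * r - s * w) * (t * s + w * r))
      ≡⟨ factor q d z H n p ⟩
    + 2 * p * t * w * s * r + c * ((n + q * q * (d * d) - H) * u + H * (u + + 2 * p * d * n * z))
      ≡⟨ cong₂ (λ a b → + 2 * p * t * w * s * r + c * (a * u + H * b)) (ℤP.+-inverseʳ H) (curve-in-z-H on) ⟩
    + 2 * p * t * w * s * r + c * (+ 0 * u + H * + 0)
      ≡⟨ vanish (+ 2 * p * t * w * s * r) c u H ⟩
    + 2 * p * t * w * s * r ∎
    where
    open ≡-Reasoning
    c = q * q * d * z * H
    u = n * H * H - z * z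
    factor : ∀ q d z H n p →
      q * (((q * d * z) * (q * d * H) - (- z) * (n * H)) * ((q * d * z) * (- z) + (n * H) * (q * d * H)))
      ≡ + 2 * p * (q * d * z) * (n * H) * (- z) * (q * d * H)
        + q * q * d * z * H * ((n + q * q * (d * d) - H) * (n * H * H - z * z) + H * (n * H * H - z * z + + 2 * p * d * n * z))
    factor = solve-∀
    vanish : ∀ e c u H → e + c * (+ 0 * u + H * + 0) ≡ e
    vanish = solve-∀

  abscissae-difference : OnCurve (curveA p q) (curveB p q) (n , d , y) →
    (odd-leg t w * even-leg s r - odd-leg s r * even-leg t w) * q ≡ p * (even-leg t w * even-leg s r)
  abscissae-difference on = begin
    (odd-leg t w * even-leg s r - odd-leg s r * even-leg t w) * q  ≡⟨ cong (_* q) (legs-difference t w s r) ⟩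
    + 2 * ((t * r - s * w) * (t * s + w * r)) * q                   ≡⟨ regroup ((t * r - s * w) * (t * s + w * r)) q ⟩
    + 2 * (q * ((t * r - s * w) * (t * s + w * r)))                 ≡⟨ cong (+ 2 *_) (product-relation on) ⟩
    + 2 * (+ 2 * p * t * w * s * r)                                 ≡⟨ regroup′ p t w s r ⟩
    p * (even-leg t w * even-leg s r)                               ∎
    where
    open ≡-Reasoning
    regroup : ∀ x q → + 2 * x * q ≡ + 2 * (q * x)
    regroup = solve-∀
    regroup′ : ∀ p t w s r → + 2 * (+ 2 * p * t * w * s * r) ≡ p * (+ 2 * t * w * (+ 2 * s * r))
    regroup′ = solve-∀

  module Parities (k : ℕ) (odd-q : Odd q) (odd-n : Odd n) (odd-y : Odd y) {e : ℤ} (odd-e : Odd e)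
           (d≡2^[1+k]e : d ≡ + (2 ℕ.^ suc k) * e) where
    h : ℤ
    h = + (2 ℕ.^ k) * e

    d≡2h : d ≡ + 2 * h
    d≡2h = trans d≡2^[1+k]e (2^suc-* k e)

    d≢0 : d ≢ + 0
    d≢0 = subst (_≢ + 0) (sym d≡2^[1+k]e) (*-≢0 (2^≢0 (suc k)) (odd⇒≢0 odd-e))

    odd-z : Odd z
    odd-z = subst (λ d → Odd (p * n * d - y)) (sym d≡2h)
              (subst Odd (regroup p n h y) (even-odd (p * n * h) odd-y))
      where
      regroup : ∀ p n h y → + 2 * (p * n * h) - y ≡ p * n * (+ 2 * h) - y
      regroup = solve-∀

    odd-H : Odd H
    odd-H = subst (λ d → Odd (n + q * q * (d * d))) (sym d≡2h)
              (subst Odd (regroup n q h) (even+odd (+ 2 * q * q * h * h) odd-n))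
      where
      regroup : ∀ n q h → + 2 * (+ 2 * q * q * h * h) + n ≡ n + q * q * ((+ 2 * h) * (+ 2 * h))
      regroup = solve-∀

    odd-w : Odd w
    odd-w = odd-* odd-n odd-H

    odd-leg-odd : Odd (odd-leg t w)
    odd-leg-odd = subst (λ d → Odd ((q * d * z) * (q * d * z) - w * w)) (sym d≡2h)
                    (subst Odd (regroup q h z w) (even-odd (+ 2 * q * h * z * q * h * z) (odd-* odd-w odd-w)))
      where
      regroup : ∀ q h z w → + 2 * (+ 2 * q * h * z * q * h * z) - w * w ≡ (q * (+ 2 * h) * z) * (q * (+ 2 * h) * z) - w * w
      regroup = solve-∀

    even-leg≡2^[1+k]* : even-leg t w ≡ + (2 ℕ.^ suc k) * (+ 2 * q * e * z * w)
    even-leg≡2^[1+k]* = subst (λ d → + 2 * (q * d * z) * w ≡ + (2 ℕ.^ suc k) * (+ 2 * q * e * z * w))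
                          (sym d≡2^[1+k]e) (regroup q (+ (2 ℕ.^ suc k)) e z w)
      where
      regroup : ∀ q a e z w → + 2 * (q * (a * e) * z) * w ≡ a * (+ 2 * q * e * z * w)
      regroup = solve-∀

    even-leg-tw≢0 : even-leg t w ≢ + 0
    even-leg-tw≢0 = *-≢0 (*-≢0 2≢0 (*-≢0 (*-≢0 (odd⇒≢0 odd-q) d≢0) (odd⇒≢0 odd-z))) (odd⇒≢0 odd-w)

    even-leg-sr≢0 : even-leg s r ≢ + 0
    even-leg-sr≢0 = *-≢0 (*-≢0 2≢0 (odd⇒≢0 (odd-neg odd-z))) (*-≢0 (*-≢0 (odd⇒≢0 odd-q) d≢0) (odd⇒≢0 odd-H))

module Fractions where
  open import Data.Integer.Base using () renaming (_+_ to _+ℤ_; _*_ to _*ℤ_; _-_ to _-ℤ_; -_ to -ℤ_)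
  open import Data.Integer.Tactic.RingSolver using () renaming (solve-∀ to solveℤ-∀)
  open import Data.Rational.Base using (ℚ; 0ℚ; 1ℚ; _+_; _*_; _-_; -_; 1/_; ≢-nonZero; toℚᵘ; ↥_; ↧_; ↧ₙ_)
  open import Data.Rational.Literals using (fromℤ)
  import Data.Nat.Divisibility as ℕD
  import Data.Rational.Properties as ℚP
  open import Data.Rational.Unnormalised.Base using (*≡*)
  import Data.Rational.Unnormalised.Properties as ℚᵘP
  open import Relation.Nullary.Decidable using (dec⇒maybe)
  open import Level using (0ℓ)
  import Tactic.RingSolver as RingSolver
  open import Tactic.RingSolver.Core.AlmostCommutativeRing using (AlmostCommutativeRing; fromCommutativeRing)

  ringℚ : AlmostCommutativeRing 0ℓ 0ℓ
  ringℚ = fromCommutativeRing ℚP.+-*-commutativeRing (λ x → dec⇒maybe (0ℚ ℚP.≟ x))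

  fromℤ-+ : ∀ a b → fromℤ (a +ℤ b) ≡ fromℤ a + fromℤ b
  fromℤ-+ a b = ℚP.toℚᵘ-injective (ℚᵘP.≃-trans (*≡* (expand a b)) (ℚᵘP.≃-sym (ℚP.toℚᵘ-homo-+ (fromℤ a) (fromℤ b))))
    where
    expand : ∀ a b → (a +ℤ b) *ℤ + 1 ≡ (a *ℤ + 1 +ℤ b *ℤ + 1) *ℤ + 1
    expand = solveℤ-∀

  fromℤ-* : ∀ a b → fromℤ (a *ℤ b) ≡ fromℤ a * fromℤ b
  fromℤ-* a b = ℚP.toℚᵘ-injective (ℚᵘP.≃-sym (ℚP.toℚᵘ-homo-* (fromℤ a) (fromℤ b)))

  fromℤ-neg : ∀ a → fromℤ (-ℤ a) ≡ - fromℤ a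
  fromℤ-neg a = ℚP.toℚᵘ-injective (ℚᵘP.≃-sym (ℚP.toℚᵘ-homo‿- (fromℤ a)))

  fromℤ-sub : ∀ a b → fromℤ (a -ℤ b) ≡ fromℤ a - fromℤ b
  fromℤ-sub a b = trans (fromℤ-+ a (-ℤ b)) (cong (λ x → fromℤ a + x) (fromℤ-neg b))

  fromℤ-injective : ∀ {a b} → fromℤ a ≡ fromℤ b → a ≡ b
  fromℤ-injective refl = refl

  fromℤ≢0 : ∀ {a} → a ≢ + 0 → fromℤ a ≢ 0ℚ
  fromℤ≢0 a≢0 = a≢0 ∘ fromℤ-injective

  1/fromℤ : (b : ℤ) → b ≢ + 0 → ℚ
  1/fromℤ b b≢0 = (1/ fromℤ b) {{≢-nonZero (fromℤ≢0 b≢0)}}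

  *-1/fromℤ : ∀ b b≢0 → fromℤ b * 1/fromℤ b b≢0 ≡ 1ℚ
  *-1/fromℤ b b≢0 = ℚP.*-inverseʳ (fromℤ b) {{≢-nonZero (fromℤ≢0 b≢0)}}

  frac : (a b : ℤ) → b ≢ + 0 → ℚ
  frac a b b≢0 = fromℤ a * 1/fromℤ b b≢0

  frac-*-denominator : ∀ a b b≢0 → frac a b b≢0 * fromℤ b ≡ fromℤ a
  frac-*-denominator a b b≢0 = begin
    fromℤ a * i * fromℤ b   ≡⟨ regroup (fromℤ a) i (fromℤ b) ⟩
    fromℤ a * (fromℤ b * i) ≡⟨ cong (fromℤ a *_) (*-1/fromℤ b b≢0) ⟩
    fromℤ a * 1ℚ            ≡⟨ ℚP.*-identityʳ (fromℤ a) ⟩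
    fromℤ a                 ∎
    where
    open ≡-Reasoning
    i = 1/fromℤ b b≢0
    regroup : ∀ a i b → a * i * b ≡ a * (b * i)
    regroup = RingSolver.solve-∀ ringℚ

  frac-pythagoras : ∀ a b c c≢0 → a *ℤ a ≡ b *ℤ b +ℤ c *ℤ c →
    frac a c c≢0 * frac a c c≢0 ≡ frac b c c≢0 * frac b c c≢0 + 1ℚ
  frac-pythagoras a b c c≢0 a²≡b²+c² = begin
    (A * i) * (A * i)                       ≡⟨ regroup A i ⟩
    (A * A) * (i * i)                       ≡⟨ cong (_* (i * i)) A²≡B²+C² ⟩
    (B * B + C * C) * (i * i)               ≡⟨ expand B C i ⟩
    (B * i) * (B * i) + (C * i) * (C * i)   ≡⟨ cong (λ u → (B * i) * (B * i) + u * u) (*-1/fromℤ c c≢0) ⟩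
    (B * i) * (B * i) + 1ℚ                  ∎
    where
    open ≡-Reasoning
    A = fromℤ a
    B = fromℤ b
    C = fromℤ c
    i = 1/fromℤ c c≢0
    A²≡B²+C² : A * A ≡ B * B + C * C
    A²≡B²+C² = begin
      A * A                       ≡⟨ fromℤ-* a a ⟨
      fromℤ (a *ℤ a)              ≡⟨ cong fromℤ a²≡b²+c² ⟩
      fromℤ (b *ℤ b +ℤ c *ℤ c)    ≡⟨ fromℤ-+ (b *ℤ b) (c *ℤ c) ⟩
      fromℤ (b *ℤ b) + fromℤ (c *ℤ c) ≡⟨ cong₂ _+_ (fromℤ-* b b) (fromℤ-* c c) ⟩
      B * B + C * C               ∎
    regroup : ∀ A i → (A * i) * (A * i) ≡ (A * A) * (i * i)
    regroup = RingSolver.solve-∀ ringℚ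
    expand : ∀ B C i → (B * B + C * C) * (i * i) ≡ (B * i) * (B * i) + (C * i) * (C * i)
    expand = RingSolver.solve-∀ ringℚ

  frac-difference : ∀ a₁ b₁ b₁≢0 a₂ b₂ b₂≢0 a₃ b₃ b₃≢0 →
    (a₁ *ℤ b₃ -ℤ a₃ *ℤ b₁) *ℤ b₂ ≡ a₂ *ℤ (b₁ *ℤ b₃) →
    frac a₁ b₁ b₁≢0 - frac a₂ b₂ b₂≢0 ≡ frac a₃ b₃ b₃≢0
  frac-difference a₁ b₁ b₁≢0 a₂ b₂ b₂≢0 a₃ b₃ b₃≢0 cross = begin
    A₁ * i₁ - A₂ * i₂
      ≡⟨ expand A₁ A₂ A₃ B₁ B₂ B₃ i₁ i₂ i₃ ⟩
    A₃ * i₃ + (L - R) * (i₁ * i₂ * i₃)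
      + A₁ * i₁ * (1ℚ - u₂ * u₃) - A₂ * i₂ * (1ℚ - u₁ * u₃) - A₃ * i₃ * (1ℚ - u₁ * u₂)
      ≡⟨ collapse A₁ A₂ A₃ i₁ i₂ i₃ L R u₁ u₂ u₃ L≡R
           (*-1/fromℤ b₁ b₁≢0) (*-1/fromℤ b₂ b₂≢0) (*-1/fromℤ b₃ b₃≢0) ⟩
    A₃ * i₃ ∎
    where
    open ≡-Reasoning
    A₁ = fromℤ a₁ ; A₂ = fromℤ a₂ ; A₃ = fromℤ a₃
    B₁ = fromℤ b₁ ; B₂ = fromℤ b₂ ; B₃ = fromℤ b₃
    i₁ = 1/fromℤ b₁ b₁≢0 ; i₂ = 1/fromℤ b₂ b₂≢0 ; i₃ = 1/fromℤ b₃ b₃≢0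
    u₁ = B₁ * i₁ ; u₂ = B₂ * i₂ ; u₃ = B₃ * i₃
    L = (A₁ * B₃ - A₃ * B₁) * B₂
    R = A₂ * (B₁ * B₃)
    L≡R : L ≡ R
    L≡R = begin
      (A₁ * B₃ - A₃ * B₁) * B₂                ≡⟨ cong (_* B₂) (cong₂ _-_ (fromℤ-* a₁ b₃) (fromℤ-* a₃ b₁)) ⟨
      (fromℤ (a₁ *ℤ b₃) - fromℤ (a₃ *ℤ b₁)) * B₂ ≡⟨ cong (_* B₂) (fromℤ-sub (a₁ *ℤ b₃) (a₃ *ℤ b₁)) ⟨
      fromℤ (a₁ *ℤ b₃ -ℤ a₃ *ℤ b₁) * B₂       ≡⟨ fromℤ-* (a₁ *ℤ b₃ -ℤ a₃ *ℤ b₁) b₂ ⟨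
      fromℤ ((a₁ *ℤ b₃ -ℤ a₃ *ℤ b₁) *ℤ b₂)    ≡⟨ cong fromℤ cross ⟩
      fromℤ (a₂ *ℤ (b₁ *ℤ b₃))                ≡⟨ fromℤ-* a₂ (b₁ *ℤ b₃) ⟩
      A₂ * fromℤ (b₁ *ℤ b₃)                   ≡⟨ cong (A₂ *_) (fromℤ-* b₁ b₃) ⟩
      A₂ * (B₁ * B₃)                          ∎
    expand : ∀ A₁ A₂ A₃ B₁ B₂ B₃ i₁ i₂ i₃ → A₁ * i₁ - A₂ * i₂ ≡
      A₃ * i₃ + ((A₁ * B₃ - A₃ * B₁) * B₂ - A₂ * (B₁ * B₃)) * (i₁ * i₂ * i₃)
        + A₁ * i₁ * (1ℚ - (B₂ * i₂) * (B₃ * i₃))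
        - A₂ * i₂ * (1ℚ - (B₁ * i₁) * (B₃ * i₃))
        - A₃ * i₃ * (1ℚ - (B₁ * i₁) * (B₂ * i₂))
    expand = RingSolver.solve-∀ ringℚ
    simplify : ∀ A₁ A₂ A₃ i₁ i₂ i₃ R →
      A₃ * i₃ + (R - R) * (i₁ * i₂ * i₃)
        + A₁ * i₁ * (1ℚ - 1ℚ * 1ℚ) - A₂ * i₂ * (1ℚ - 1ℚ * 1ℚ) - A₃ * i₃ * (1ℚ - 1ℚ * 1ℚ) ≡ A₃ * i₃
    simplify = RingSolver.solve-∀ ringℚ
    collapse : ∀ A₁ A₂ A₃ i₁ i₂ i₃ L R u₁ u₂ u₃ → L ≡ R → u₁ ≡ 1ℚ → u₂ ≡ 1ℚ → u₃ ≡ 1ℚ →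
      A₃ * i₃ + (L - R) * (i₁ * i₂ * i₃)
        + A₁ * i₁ * (1ℚ - u₂ * u₃) - A₂ * i₂ * (1ℚ - u₁ * u₃) - A₃ * i₃ * (1ℚ - u₁ * u₂) ≡ A₃ * i₃
    collapse A₁ A₂ A₃ i₁ i₂ i₃ L _ _ _ _ refl refl refl refl = simplify A₁ A₂ A₃ i₁ i₂ i₃ L

  *-fromℤ⇒cross : ∀ x a b → x * fromℤ b ≡ fromℤ a → ↥ x *ℤ b ≡ a *ℤ ↧ x
  *-fromℤ⇒cross x@record{} a b x*b≡a
    with ℚᵘP.≃-trans (ℚᵘP.≃-sym (ℚP.toℚᵘ-homo-* x (fromℤ b))) (ℚP.toℚᵘ-cong x*b≡a)
  ... | *≡* eq = trans (sym (ℤP.*-identityʳ (↥ x *ℤ b))) (trans eq (cong (λ n → a *ℤ + n) (ℕP.*-identityʳ (↧ₙ x))))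

  frac-denominator : ∀ a b b≢0 m {c} → Odd a → b ≡ + (2 ℕ.^ m) *ℤ c → 2 ℕ.^ m ℕD.∣ ↧ₙ frac a b b≢0
  frac-denominator a b b≢0 m {c} odd-a b≡2^m*c =
    2^∣odd*⇒2^∣ m ℤ.∣ a ∣ (↧ₙ x) (odd⇒∤ odd-a) (subst (2 ℕ.^ m ℕD.∣_) cross (ℕD.∣n⇒∣m*n ℤ.∣ ↥ x ∣ 2^m∣b))
    where
    x = frac a b b≢0
    cross : ℤ.∣ ↥ x ∣ ℕ.* ℤ.∣ b ∣ ≡ ℤ.∣ a ∣ ℕ.* ↧ₙ x
    cross = begin
      ℤ.∣ ↥ x ∣ ℕ.* ℤ.∣ b ∣  ≡⟨ ℤP.abs-* (↥ x) b ⟨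
      ℤ.∣ ↥ x *ℤ b ∣          ≡⟨ cong ℤ.∣_∣ (*-fromℤ⇒cross x a b (frac-*-denominator a b b≢0)) ⟩
      ℤ.∣ a *ℤ ↧ x ∣          ≡⟨ ℤP.abs-* a (↧ x) ⟩
      ℤ.∣ a ∣ ℕ.* ↧ₙ x        ∎
      where open ≡-Reasoning
    2^m∣b : 2 ℕ.^ m ℕD.∣ ℤ.∣ b ∣
    2^m∣b = ℕD.divides ℤ.∣ c ∣
              (trans (cong ℤ.∣_∣ b≡2^m*c) (trans (ℤP.abs-* (+ (2 ℕ.^ m)) c) (ℕP.*-comm (2 ℕ.^ m) ℤ.∣ c ∣)))

open Fractions

module GoodPoints where
  open import Data.Rational.Base using (0ℚ; 1ℚ; _+_; _*_; _-_; -_; ∣_∣; ↧ₙ_)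
  import Data.Rational.Properties as ℚP
  import Data.Nat.Divisibility as ℕD
  import Tactic.RingSolver as RingSolver
  open import Data.List.Base using (map)
  open import Data.List.Extrema.Nat using (max; xs≤max)
  import Data.List.Relation.Unary.All as All
  open import Data.List.Membership.Propositional.Properties using (∈-map⁺)

  ∣x∣*∣x∣≡x*x : ∀ x → ∣ x ∣ * ∣ x ∣ ≡ x * x
  ∣x∣*∣x∣≡x*x x with ℚP.∣p∣≡p∨∣p∣≡-p x
  ... | inj₁ ∣x∣≡x  rewrite ∣x∣≡x  = refl
  ... | inj₂ ∣x∣≡-x rewrite ∣x∣≡-x = neg*neg x
    where
    neg*neg : ∀ x → (- x) * (- x) ≡ x * x
    neg*neg = RingSolver.solve-∀ ringℚ

  square⇒rationalDistance : ∀ P Q r → r * r ≡ dist² P Q → RationalDistance P Q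
  square⇒rationalDistance P Q r r²≡d² = ∣ r ∣ , ℚP.0≤∣p∣ r , trans (∣x∣*∣x∣≡x*x r) r²≡d²

  goodPoint-on-axis : ∀ a X U V → U * U ≡ X * X + 1ℚ → V * V ≡ (X - a) * (X - a) + 1ℚ → GoodPoint a (X , 0ℚ)
  goodPoint-on-axis a X U V U²≡X²+1 V²≡[X-a]²+1 =
    square⇒rationalDistance (X , 0ℚ) (P₁ a) X (to-P₁ X) ,
    square⇒rationalDistance (X , 0ℚ) (P₂ a) U (trans U²≡X²+1 (to-P₂ X)) ,
    square⇒rationalDistance (X , 0ℚ) (P₃ a) (X - a) (to-P₃ X a) ,
    square⇒rationalDistance (X , 0ℚ) (P₄ a) V (trans V²≡[X-a]²+1 (to-P₄ X a))
    where
    to-P₁ : ∀ X → X * X ≡ (X - 0ℚ) * (X - 0ℚ) + (0ℚ - 0ℚ) * (0ℚ - 0ℚ)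
    to-P₁ = RingSolver.solve-∀ ringℚ
    to-P₂ : ∀ X → X * X + 1ℚ ≡ (X - 0ℚ) * (X - 0ℚ) + (0ℚ - 1ℚ) * (0ℚ - 1ℚ)
    to-P₂ = RingSolver.solve-∀ ringℚ
    to-P₃ : ∀ X a → (X - a) * (X - a) ≡ (X - a) * (X - a) + (0ℚ - 0ℚ) * (0ℚ - 0ℚ)
    to-P₃ = RingSolver.solve-∀ ringℚ
    to-P₄ : ∀ X a → (X - a) * (X - a) + 1ℚ ≡ (X - a) * (X - a) + (0ℚ - 1ℚ) * (0ℚ - 1ℚ)
    to-P₄ = RingSolver.solve-∀ ringℚ

  unbounded⇒infinitelyMany : ∀ {A : Set} {P : A → Set} (f : A → ℕ) →
    (∀ k → ∃ λ x → P x × k ℕ.< f x) → InfinitelyMany P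
  unbounded⇒infinitelyMany f unbounded L =
    let x , Px , bound<fx = unbounded (max 0 (map f L))
    in x , Px , λ x∈L → ℕP.<⇒≱ bound<fx (All.lookup (xs≤max 0 (map f L)) (∈-map⁺ f x∈L))

  curvePoint⇒goodPoint : ∀ p q (odd-q : Odd q) k n d y →
    OnCurve (curveA p q) (curveB p q) (n , d , y) → TwoAdic k (n , d , y) →
    ∃ λ X → GoodPoint (frac p q (odd⇒≢0 odd-q)) (X , 0ℚ) × 2 ℕ.^ suc k ℕD.∣ ↧ₙ X
  curvePoint⇒goodPoint p q odd-q k n d y on (odd-n , odd-y , _ , odd-e , d≡2^[1+k]e) =
    X , goodPoint-on-axis a X U V U²≡X²+1 (subst (λ Z → V * V ≡ Z * Z + 1ℚ) (sym X-a≡Y) V²≡Y²+1) ,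
    frac-denominator (odd-leg t w) (even-leg t w) even-leg-tw≢0 (suc k) odd-leg-odd even-leg≡2^[1+k]*
    where
    open CurveAbscissae p q n d y
    open Parities k odd-q odd-n odd-y odd-e d≡2^[1+k]e
    a = frac p q (odd⇒≢0 odd-q)
    X = frac (odd-leg t w) (even-leg t w) even-leg-tw≢0
    U = frac (hypotenuse t w) (even-leg t w) even-leg-tw≢0
    Y = frac (odd-leg s r) (even-leg s r) even-leg-sr≢0
    V = frac (hypotenuse s r) (even-leg s r) even-leg-sr≢0
    U²≡X²+1 : U * U ≡ X * X + 1ℚ
    U²≡X²+1 = frac-pythagoras (hypotenuse t w) (odd-leg t w) (even-leg t w) even-leg-tw≢0 (pythagoras t w)
    V²≡Y²+1 : V * V ≡ Y * Y + 1ℚ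
    V²≡Y²+1 = frac-pythagoras (hypotenuse s r) (odd-leg s r) (even-leg s r) even-leg-sr≢0 (pythagoras s r)
    X-a≡Y : X - a ≡ Y
    X-a≡Y = frac-difference (odd-leg t w) (even-leg t w) even-leg-tw≢0 p q (odd⇒≢0 odd-q)
              (odd-leg s r) (even-leg s r) even-leg-sr≢0 (abscissae-difference on)

open GoodPoints

module AdmissibleParameters where
  open import Data.Integer.Base using (_+_; _*_; _-_; -_)
  open import Data.Integer.Tactic.RingSolver using (solve-∀)
  open import Data.Rational.Base using (0ℚ; ↧ₙ_)
  import Data.Nat.Divisibility as ℕD

  -- p / q = h (2R / e₂) - h (S / 2e₂) for h u = (u - 1/u) / 2
  record Admissible (p q : ℤ) : Set where
    constructor admissible
    field
      {e₁ e₂ S R}   : ℤ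
      odd-e₂        : Odd e₂
      odd-S         : Odd S
      odd-R         : Odd R
      e₁≡4R-S       : e₁ ≡ + 4 * R - S
      q≡e₂SR        : q ≡ e₂ * S * R
      4p≡e₁[SR+e₂²] : + 4 * p ≡ e₁ * (S * R + e₂ * e₂)

    odd-e₁ : Odd e₁
    odd-e₁ = subst Odd (trans (regroup R S) (sym e₁≡4R-S)) (even-odd (+ 2 * R) odd-S)
      where
      regroup : ∀ R S → + 2 * (+ 2 * R) - S ≡ + 4 * R - S
      regroup = solve-∀

    odd-q : Odd q
    odd-q = subst Odd (sym q≡e₂SR) (odd-* (odd-* odd-e₂ odd-S) odd-R)

    q≢0 : q ≢ + 0
    q≢0 = odd⇒≢0 odd-q

    -- the point of y² = x³ + (p² + 2q²) x² + q⁴ x giving the abscissa X = h (2R / e₂)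
    initialPoint : WeightedPoint
    initialPoint = - (e₂ * e₂ * (S * S * S) * R) , + 2 , e₂ * (S * S * S) * R * (e₁ * q - + 2 * (e₂ * p))

    initialPoint-twoAdic : TwoAdic 0 initialPoint
    initialPoint-twoAdic =
      odd-neg (odd-* (odd-* (odd-* odd-e₂ odd-e₂) odd-S³) odd-R) ,
      odd-* (odd-* (odd-* odd-e₂ odd-S³) odd-R) (odd-even (e₂ * p) (odd-* odd-e₁ odd-q)) ,
      + 1 , odd-1 , refl
      where odd-S³ = odd-* (odd-* odd-S odd-S) odd-S

  admissible-neg : ∀ {p q} → Admissible p q → Admissible (- p) q
  admissible-neg {p} (admissible {e₁} {e₂} {S} {R} odd-e₂ odd-S odd-R e₁≡4R-S q≡e₂SR 4p≡e₁[SR+e₂²]) =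
    admissible odd-e₂ (odd-neg odd-S) (odd-neg odd-R)
      (trans (cong -_ e₁≡4R-S) (neg-e₁ R S))
      (trans q≡e₂SR (neg-q e₂ S R))
      (trans (neg-4p p) (trans (cong -_ 4p≡e₁[SR+e₂²]) (neg-p e₁ e₂ S R)))
    where
    neg-e₁ : ∀ R S → - (+ 4 * R - S) ≡ + 4 * - R - - S
    neg-e₁ = solve-∀
    neg-q : ∀ e₂ S R → e₂ * S * R ≡ e₂ * - S * - R
    neg-q = solve-∀
    neg-4p : ∀ p → + 4 * - p ≡ - (+ 4 * p)
    neg-4p = solve-∀
    neg-p : ∀ e₁ e₂ S R → - (e₁ * (S * R + e₂ * e₂)) ≡ - e₁ * (- S * - R + e₂ * e₂)
    neg-p = solve-∀

  initialPoint-onCurve : ∀ {p q} (adm : Admissible p q) → OnCurve (curveA p q) (curveB p q) (Admissible.initialPoint adm)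
  initialPoint-onCurve {p} (admissible {e₂ = e₂} {S} {R} _ _ _ refl refl 4p≡) = begin
    y * y                                  ≡⟨ expand e₂ S R p ⟩
    cubic A B n (+ 2) + c * (e₁ * (S * R + e₂ * e₂) - + 4 * p)
                                           ≡⟨ cong (λ x → cubic A B n (+ 2) + c * (x - + 4 * p)) 4p≡ ⟨
    cubic A B n (+ 2) + c * (+ 4 * p - + 4 * p) ≡⟨ cong (λ x → cubic A B n (+ 2) + c * x) (ℤP.+-inverseʳ (+ 4 * p)) ⟩
    cubic A B n (+ 2) + c * + 0            ≡⟨ vanish (cubic A B n (+ 2)) c ⟩
    cubic A B n (+ 2)                      ∎
    where
    open ≡-Reasoning
    e₁ = + 4 * R - S
    q = e₂ * S * R
    A = curveA p q
    B = curveB p q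
    n = - (e₂ * e₂ * (S * S * S) * R)
    y = e₂ * (S * S * S) * R * (e₁ * q - + 2 * (e₂ * p))
    c = e₂ * e₂ * (e₂ * e₂) * (S * S * S * S * S * S * S) * (R * R * R) * e₁
    vanish : ∀ x c → x + c * + 0 ≡ x
    vanish = solve-∀
    expand : ∀ e₂ S R p →
      let e₁ = + 4 * R - S
          q = e₂ * S * R
          n = - (e₂ * e₂ * (S * S * S) * R)
          y = e₂ * (S * S * S) * R * (e₁ * q - + 2 * (e₂ * p))
          A = p * p + + 2 * (q * q)
          B = q * q * (q * q)
      in y * y ≡ n * n * n + A * (n * n) * (+ 2 * + 2) + B * n * (+ 2 * + 2 * (+ 2 * + 2))
                 + e₂ * e₂ * (e₂ * e₂) * (S * S * S * S * S * S * S) * (R * R * R) * e₁ * (e₁ * (S * R + e₂ * e₂) - + 4 * p)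
    expand = solve-∀

  admissible⇒goodParameter : ∀ {p q} (adm : Admissible p q) → GoodParameter (frac p q (Admissible.q≢0 adm))
  admissible⇒goodParameter {p} {q} adm = unbounded⇒infinitelyMany (↧ₙ_ ∘ proj₁) λ k →
    let on , two-adic = multiples-onCurve-twoAdic (curveA p q) (curveB p q) initialPoint
                          (initialPoint-onCurve adm) initialPoint-twoAdic k
        X , good , 2^[1+k]∣X = curvePoint⇒goodPoint p q odd-q k _ _ _ on two-adic
    in (X , 0ℚ) , good , ℕP.≤-trans (ℕP.<⇒≤ (n<2^n (suc k))) (ℕD.∣⇒≤ 2^[1+k]∣X)
    where open Admissible adm

-- e₁ / 4e₂ exceeds m / D by k / 4e₂D, where k = D + 4m < 2e₂, and the factor 1 + e₂² / SR
-- by which p / q exceeds e₁ / 4e₂ is small enough to keep p / q below (m + 1) / D.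
module Approximation (m D-1 : ℕ) where
  open import Data.Nat.Base using (_+_; _*_; _≤_; _<_)
  open import Data.Nat.Tactic.RingSolver using (solve-∀)
  import Data.Integer.Tactic.RingSolver as ℤSolver

  D k f₁ f₂ e₁ e₂ S R G p q : ℕ
  D  = suc D-1
  k  = D + 4 * m
  f₁ = 4 * m * suc k
  f₂ = D-1 * suc k + k
  e₁ = suc (2 * f₁)
  e₂ = suc (2 * f₂)
  R  = e₁ + 4 * D * e₂
  S  = 3 * e₁ + 16 * D * e₂
  G  = 3 * f₁ * f₁ + 3 * f₁ + f₂ * f₂ + f₂ + 1 + 7 * D * e₁ * e₂ + 16 * D * D * e₂ * e₂
  p  = e₁ * G
  q  = e₂ * S * R

  S+e₁≡4R : S + e₁ ≡ 4 * R
  S+e₁≡4R = identity e₁ D e₂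
    where
    identity : ∀ e₁ D e₂ → 3 * e₁ + 16 * D * e₂ + e₁ ≡ 4 * (e₁ + 4 * D * e₂)
    identity = solve-∀

  4G≡SR+e₂² : 4 * G ≡ S * R + e₂ * e₂
  4G≡SR+e₂² = identity f₁ f₂ D
    where
    identity : ∀ f₁ f₂ D →
      4 * (3 * f₁ * f₁ + 3 * f₁ + f₂ * f₂ + f₂ + 1
             + 7 * D * suc (2 * f₁) * suc (2 * f₂) + 16 * D * D * suc (2 * f₂) * suc (2 * f₂))
      ≡ (3 * suc (2 * f₁) + 16 * D * suc (2 * f₂)) * (suc (2 * f₁) + 4 * D * suc (2 * f₂)) + suc (2 * f₂) * suc (2 * f₂)
    identity = solve-∀

  4p≡e₁[SR+e₂²] : 4 * p ≡ e₁ * (S * R + e₂ * e₂)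
  4p≡e₁[SR+e₂²] = trans (regroup e₁ G) (cong (e₁ *_) 4G≡SR+e₂²)
    where
    regroup : ∀ e₁ G → 4 * (e₁ * G) ≡ e₁ * (4 * G)
    regroup = solve-∀

  e₁D≡4e₂m+k : e₁ * D ≡ 4 * e₂ * m + k
  e₁D≡4e₂m+k = identity m D-1 k
    where
    identity : ∀ m D-1 k → suc (2 * (4 * m * suc k)) * suc D-1 ≡ 4 * suc (2 * (D-1 * suc k + k)) * m + (suc D-1 + 4 * m)
    identity = solve-∀

  4pD≡4mq+excess : 4 * (p * D) ≡ 4 * (m * q) + (k * (S * R) + e₁ * D * e₂ * e₂)
  4pD≡4mq+excess = begin
    4 * (p * D)                             ≡⟨ regroup₁ e₁ G D ⟩
    4 * G * (e₁ * D)                        ≡⟨ cong₂ _*_ 4G≡SR+e₂² e₁D≡4e₂m+k ⟩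
    (S * R + e₂ * e₂) * (4 * e₂ * m + k)    ≡⟨ regroup₂ S R e₂ m k ⟩
    4 * (m * q) + (k * (S * R) + (4 * e₂ * m + k) * e₂ * e₂)
                                            ≡⟨ cong (λ x → 4 * (m * q) + (k * (S * R) + x * e₂ * e₂)) e₁D≡4e₂m+k ⟨
    4 * (m * q) + (k * (S * R) + e₁ * D * e₂ * e₂) ∎
    where
    open ≡-Reasoning
    regroup₁ : ∀ e₁ G D → 4 * (e₁ * G * D) ≡ 4 * G * (e₁ * D)
    regroup₁ = solve-∀
    regroup₂ : ∀ S R e₂ m k →
      (S * R + e₂ * e₂) * (4 * e₂ * m + k) ≡ 4 * (m * (e₂ * S * R)) + (k * (S * R) + (4 * e₂ * m + k) * e₂ * e₂)
    regroup₂ = solve-∀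

  excess<4q : k * (S * R) + e₁ * D * e₂ * e₂ < 4 * q
  excess<4q = ℕP.<-≤-trans (ℕP.+-mono-<-≤ (ℕP.*-monoˡ-< (S * R) k<2e₂) e₁De₂²≤2e₂SR) (ℕP.≤-reflexive (regroup e₂ S R))
    where
    k<2e₂ : k < 2 * e₂
    k<2e₂ = ℕP.≤-trans (ℕP.m≤m+n (suc k) _) (ℕP.≤-reflexive (sym (identity D-1 k)))
      where
      identity : ∀ D-1 k → 2 * suc (2 * (D-1 * suc k + k)) ≡ suc k + (4 * D-1 * suc k + 3 * k + 1)
      identity = solve-∀
    e₁De₂²≤2e₂SR : e₁ * D * e₂ * e₂ ≤ 2 * e₂ * (S * R)
    e₁De₂²≤2e₂SR = ℕP.≤-trans (ℕP.m≤m+n _ _) (ℕP.≤-reflexive (sym (identity e₁ e₂ D)))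
      where
      identity : ∀ e₁ e₂ D → 2 * e₂ * ((3 * e₁ + 16 * D * e₂) * (e₁ + 4 * D * e₂))
                               ≡ e₁ * D * e₂ * e₂ + (6 * e₁ * e₁ * e₂ + 55 * D * e₁ * e₂ * e₂ + 128 * D * D * e₂ * e₂ * e₂)
      identity = solve-∀
    regroup : ∀ e₂ S R → 2 * e₂ * (S * R) + 2 * e₂ * (S * R) ≡ 4 * (e₂ * S * R)
    regroup = solve-∀

  m*q<p*D : m * q < p * D
  m*q<p*D = ℕP.*-cancelˡ-< 4 (m * q) (p * D)
              (ℕP.<-≤-trans (ℕP.m<m+n (4 * (m * q)) ℕ.z<s) (ℕP.≤-reflexive (sym 4pD≡4mq+excess)))

  p*D<[1+m]*q : p * D < suc m * q
  p*D<[1+m]*q = ℕP.*-cancelˡ-< 4 (p * D) (suc m * q)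
                  (ℕP.<-≤-trans (ℕP.≤-reflexive (cong suc 4pD≡4mq+excess))
                    (ℕP.≤-trans (ℕP.+-monoʳ-< (4 * (m * q)) excess<4q) (ℕP.≤-reflexive (regroup m q))))
    where
    regroup : ∀ m q → 4 * (m * q) + 4 * q ≡ 4 * (suc m * q)
    regroup = solve-∀

  open AdmissibleParameters using (Admissible; admissible)

  private
    odd-suc-2* : ∀ f → Odd (+ suc (2 * f))
    odd-suc-2* f = + f , cong (λ x → + 1 ℤ.+ x) (ℤP.pos-* 2 f)

    odd-ℕ : ∀ {n} f → n ≡ suc (2 * f) → Odd (+ n)
    odd-ℕ f refl = odd-suc-2* f

  admissible-approximation : Admissible (+ p) (+ q)
  admissible-approximation = admissible
    (odd-suc-2* f₂)
    (odd-ℕ (3 * f₁ + 1 + 8 * D * e₂) (S-odd f₁ D e₂))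
    (odd-ℕ (f₁ + 2 * D * e₂) (R-odd f₁ D e₂))
    (trans (cancel (+ S) (+ e₁)) (cong (ℤ._- + S) (trans (cong +_ S+e₁≡4R) (ℤP.pos-* 4 R))))
    (trans (ℤP.pos-* (e₂ * S) R) (cong (ℤ._* + R) (ℤP.pos-* e₂ S)))
    (begin
      + 4 ℤ.* + p                           ≡⟨ ℤP.pos-* 4 p ⟨
      + (4 * p)                             ≡⟨ cong +_ 4p≡e₁[SR+e₂²] ⟩
      + (e₁ * (S * R + e₂ * e₂))            ≡⟨ ℤP.pos-* e₁ (S * R + e₂ * e₂) ⟩
      + e₁ ℤ.* (+ (S * R) ℤ.+ + (e₂ * e₂))  ≡⟨ cong (+ e₁ ℤ.*_) (cong₂ ℤ._+_ (ℤP.pos-* S R) (ℤP.pos-* e₂ e₂)) ⟩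
      + e₁ ℤ.* (+ S ℤ.* + R ℤ.+ + e₂ ℤ.* + e₂) ∎)
    where
    open ≡-Reasoning
    S-odd : ∀ f₁ D e₂ → 3 * suc (2 * f₁) + 16 * D * e₂ ≡ suc (2 * (3 * f₁ + 1 + 8 * D * e₂))
    S-odd = solve-∀
    R-odd : ∀ f₁ D e₂ → suc (2 * f₁) + 4 * D * e₂ ≡ suc (2 * (f₁ + 2 * D * e₂))
    R-odd = solve-∀
    cancel : ∀ s e → e ≡ s ℤ.+ e ℤ.- s
    cancel = ℤSolver.solve-∀

module Density where
  open import Data.Integer.Base using (_+_; _*_; -_; _<_; +<+)
  open import Data.Integer.Tactic.RingSolver using (solve-∀)
  open import Data.Rational.Base as ℚ using (mkℚ; ↥_; ↧_; toℚᵘ)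
  open import Data.Rational.Literals using (fromℤ)
  import Data.Rational.Properties as ℚP
  open import Data.Rational.Unnormalised.Base as ℚᵘ using (mkℚᵘ; *≡*; *<*)
  import Data.Rational.Unnormalised.Properties as ℚᵘP
  open AdmissibleParameters

  pos-*-< : ∀ a b c d → a ℕ.* b ℕ.< c ℕ.* d → + a * + b < + c * + d
  pos-*-< a b c d ab<cd = subst₂ _<_ (ℤP.pos-* a b) (ℤP.pos-* c d) (+<+ ab<cd)

  -- m / 2st is the midpoint of a / s and b / t
  midpoint-neighbourhood : ∀ a b s t m p q → a * + t < b * + s → + m ≡ a * + t + b * + s →
    m ℕ.* q ℕ.< p ℕ.* (2 ℕ.* (s ℕ.* t)) → p ℕ.* (2 ℕ.* (s ℕ.* t)) ℕ.< suc m ℕ.* q →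
    a * + q < + p * + s × + p * + t < b * + q
  midpoint-neighbourhood a b s t m p q at<bs m≡at+bs mq<pD pD<[1+m]q =
    ℤP.*-cancelˡ-<-nonNeg (+ (2 ℕ.* t)) (begin-strict
      + (2 ℕ.* t) * (a * + q)        ≡⟨ cong (_* (a * + q)) (ℤP.pos-* 2 t) ⟩
      + 2 * + t * (a * + q)          ≡⟨ regroup₁ a (+ t) (+ q) ⟩
      (a * + t + a * + t) * + q      ≤⟨ ℤP.*-monoʳ-≤-nonNeg (+ q) (ℤP.<⇒≤ (ℤP.+-monoʳ-< (a * + t) at<bs)) ⟩
      (a * + t + b * + s) * + q      ≡⟨ cong (_* + q) m≡at+bs ⟨
      + m * + q                      <⟨ lower ⟩
      + p * (+ 2 * (+ s * + t))      ≡⟨ regroup₂ (+ p) (+ s) (+ t) ⟩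
      + 2 * + t * (+ p * + s)        ≡⟨ cong (_* (+ p * + s)) (ℤP.pos-* 2 t) ⟨
      + (2 ℕ.* t) * (+ p * + s)      ∎) ,
    ℤP.*-cancelˡ-<-nonNeg (+ (2 ℕ.* s)) (begin-strict
      + (2 ℕ.* s) * (+ p * + t)      ≡⟨ cong (_* (+ p * + t)) (ℤP.pos-* 2 s) ⟩
      + 2 * + s * (+ p * + t)        ≡⟨ regroup₃ (+ p) (+ s) (+ t) ⟩
      + p * (+ 2 * (+ s * + t))      <⟨ upper ⟩
      + suc m * + q                  ≤⟨ ℤP.*-monoʳ-≤-nonNeg (+ q) (ℤP.i<j⇒suc[i]≤j m<2bs) ⟩
      (b * + s + b * + s) * + q      ≡⟨ regroup₄ b (+ s) (+ q) ⟩
      + 2 * + s * (b * + q)          ≡⟨ cong (_* (b * + q)) (ℤP.pos-* 2 s) ⟨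
      + (2 ℕ.* s) * (b * + q)        ∎)
    where
    open ℤP.≤-Reasoning
    2st≡ : + (2 ℕ.* (s ℕ.* t)) ≡ + 2 * (+ s * + t)
    2st≡ = trans (ℤP.pos-* 2 (s ℕ.* t)) (cong (+ 2 *_) (ℤP.pos-* s t))
    lower : + m * + q < + p * (+ 2 * (+ s * + t))
    lower = subst (λ D → + m * + q < + p * D) 2st≡ (pos-*-< m q p (2 ℕ.* (s ℕ.* t)) mq<pD)
    upper : + p * (+ 2 * (+ s * + t)) < + suc m * + q
    upper = subst (λ D → + p * D < + suc m * + q) 2st≡ (pos-*-< p (2 ℕ.* (s ℕ.* t)) (suc m) q pD<[1+m]q)
    m<2bs : + m < b * + s + b * + s
    m<2bs = subst (_< b * + s + b * + s) (sym m≡at+bs) (ℤP.+-monoˡ-< (b * + s) at<bs)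
    regroup₁ : ∀ a t q → + 2 * t * (a * q) ≡ (a * t + a * t) * q
    regroup₁ = solve-∀
    regroup₂ : ∀ p s t → p * (+ 2 * (s * t)) ≡ + 2 * t * (p * s)
    regroup₂ = solve-∀
    regroup₃ : ∀ p s t → + 2 * s * (p * t) ≡ p * (+ 2 * (s * t))
    regroup₃ = solve-∀
    regroup₄ : ∀ b s q → (b * s + b * s) * q ≡ + 2 * s * (b * q)
    regroup₄ = solve-∀

  toℚᵘ-frac : ∀ a c c≢0 → toℚᵘ (frac a (+ suc c) c≢0) ℚᵘ.≃ mkℚᵘ a c
  toℚᵘ-frac a c c≢0 = cross⇒≃ (frac a (+ suc c) c≢0) (frac-*-denominator a (+ suc c) c≢0)
    where
    cross⇒≃ : ∀ x → x ℚ.* fromℤ (+ suc c) ≡ fromℤ a → toℚᵘ x ℚᵘ.≃ mkℚᵘ a c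
    cross⇒≃ x@record{} x*c≡a = *≡* (*-fromℤ⇒cross x a (+ suc c) x*c≡a)

  <-frac : ∀ x a c c≢0 → ↥ x * + suc c < a * ↧ x → x ℚ.< frac a (+ suc c) c≢0
  <-frac x@record{} a c c≢0 x<a/c = ℚP.toℚᵘ-cancel-< (ℚᵘP.<-respʳ-≃ (ℚᵘP.≃-sym (toℚᵘ-frac a c c≢0)) (*<* x<a/c))

  frac-< : ∀ x a c c≢0 → a * ↧ x < ↥ x * + suc c → frac a (+ suc c) c≢0 ℚ.< x
  frac-< x@record{} a c c≢0 a/c<x = ℚP.toℚᵘ-cancel-< (ℚᵘP.<-respˡ-≃ (ℚᵘP.≃-sym (toℚᵘ-frac a c c≢0)) (*<* a/c<x))

  neg-swap-< : ∀ x y u v → x * y < u * v → - u * v < - x * y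
  neg-swap-< x y u v xy<uv = subst₂ _<_ (ℤP.neg-distribˡ-* u v) (ℤP.neg-distribˡ-* x y) (ℤP.neg-mono-< xy<uv)

  admissible-between : ∀ α β → α ℚ.< β →
    ∃ λ p → ∃ λ q → Σ (Admissible p q) λ adm → let a = frac p q (Admissible.q≢0 adm) in α ℚ.< a × a ℚ.< β
  admissible-between α@(mkℚ αn a-1 _) β@(mkℚ βn b-1 _) α<β with αn * + suc b-1 + βn * + suc a-1 in midpoint
  ... | + m =
    + p , + q , adm , <-frac α (+ p) (ℕ.pred q) q≢0 (proj₁ bounds) , frac-< β (+ p) (ℕ.pred q) q≢0 (proj₂ bounds)
    where
    open Approximation m (ℕ.pred (2 ℕ.* (suc a-1 ℕ.* suc b-1)))
    adm : Admissible (+ p) (+ q)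
    adm = admissible-approximation
    q≢0 : + q ≢ + 0
    q≢0 = Admissible.q≢0 adm
    bounds : αn * + q < + p * + suc a-1 × + p * + suc b-1 < βn * + q
    bounds = midpoint-neighbourhood αn βn (suc a-1) (suc b-1) m p q (ℚP.drop-*<* α<β) (sym midpoint)
               m*q<p*D p*D<[1+m]*q
  -- a negative midpoint is handled by approximating the midpoint of - β and - α
  ... | -[1+ m ] =
    - + p , + q , adm ,
    <-frac α (- + p) (ℕ.pred q) q≢0 (subst (λ x → x * + q < - + p * + suc a-1) (ℤP.neg-involutive αn)
                                     (neg-swap-< (+ p) (+ suc a-1) (- αn) (+ q) (proj₂ bounds))) ,
    frac-< β (- + p) (ℕ.pred q) q≢0 (subst (λ x → - + p * + suc b-1 < x * + q) (ℤP.neg-involutive βn)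
                                     (neg-swap-< (- βn) (+ q) (+ p) (+ suc b-1) (proj₁ bounds)))
    where
    open Approximation (suc m) (ℕ.pred (2 ℕ.* (suc b-1 ℕ.* suc a-1)))
    adm : Admissible (- + p) (+ q)
    adm = admissible-neg admissible-approximation
    q≢0 : + q ≢ + 0
    q≢0 = Admissible.q≢0 adm
    bounds : - βn * + q < + p * + suc b-1 × + p * + suc a-1 < - αn * + q
    bounds = midpoint-neighbourhood (- βn) (- αn) (suc b-1) (suc a-1) (suc m) p q
               (neg-swap-< αn (+ suc b-1) βn (+ suc a-1) (ℚP.drop-*<* α<β))
               (trans (cong -_ (sym midpoint)) (neg-sum αn βn (+ suc a-1) (+ suc b-1)))
               m*q<p*D p*D<[1+m]*q
      where
      neg-sum : ∀ a b s t → - (a * t + b * s) ≡ - b * s + - a * t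
      neg-sum = solve-∀

open AdmissibleParameters using (Admissible; admissible⇒goodParameter)
open Density using (admissible-between)

theorem2p1 : DenseInℝ GoodParameter
theorem2p1 α β α<β =
  let p , q , adm , α<a , a<β = admissible-between α β α<β
  in frac p q (Admissible.q≢0 adm) , α<a , a<β , admissible⇒goodParameter adm
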